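{- For all integers $m \geq 1$ and $n \geq 1$, $$M(K_{1(n),m}) = M(O_m \vee K_n) \geq 2^{m+n} - 2^m + 1.$$
   Context: All graphs are finite and simple. For a connected graph $G$, a coloring of $G$ is a function $f: V(G) \to \mathbb{N}$ (positive integers); for a subgraph $H$, $f(H) = \sum_{v \in V(H)} f(v)$. $f$ is an IC-coloring if for every integer $k \in \{1, \dots, f(G)\}$ there is an induced connected subgraph $H$ of $G$ with $f(H) = k$. The IC-index $M(G)$ is the maximum of $f(G)$ over all IC-colorings $f$ of $G$. $O_m$ is the edgeless graph on $m$ vertices, $K_n$ the complete graph on $n$ vertices, and $H_0 \vee H_1$ denotes the join (disjoint union plus all edges between $V(H_0)$ and $V(H_1)$). $K_{1(n),m}$ is the complete multipartite graph with $n$ partite sets of size one and one partite set of size $m$, i.e. $O_m \vee K_n$. -}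

module Defs where

open import Data.Nat using (ℕ; zero; suc; _+_; _≤_; _^_; _∸_)
open import Data.Fin using (Fin; splitAt)
import Data.Fin as Fin
open import Data.Fin.Subset using (Subset; _∈_; Nonempty) renaming (⊤ to ⊤ˢ)
open import Data.Vec using (lookup; []; _∷_)
open import Data.Bool using (Bool; true; false; if_then_else_)
open import Data.Sum using (_⊎_; inj₁; inj₂)
open import Data.Unit using (⊤)
open import Data.Empty using (⊥)
open import Data.Product using (Σ; _×_; ∃)
open import Relation.Nullary using (¬_)
open import Relation.Binary.PropositionalEquality using (_≡_)

record Graph : Set₁ where
  field
    order  : ℕ
    Adj    : Fin order → Fin order → Set
    sym    : ∀ {u v} → Adj u v → Adj v u
    irrefl : ∀ {u} → ¬ Adj u u
open Graph public

O : ℕ → Graph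
O m = record { order = m ; Adj = λ _ _ → ⊥ ; sym = λ () ; irrefl = λ () }

K : ℕ → Graph
K n = record { order = n ; Adj = λ u v → ¬ (u ≡ v)
             ; sym = λ ne e → ne (Relation.Binary.PropositionalEquality.sym e)
             ; irrefl = λ ne → ne Relation.Binary.PropositionalEquality.refl }

-- Join H0 ∨ H1: vertices of H0 come first (Fin (order H0 + order H1)).
module _ (G H : Graph) where
  JAdj : Fin (order G) ⊎ Fin (order H) → Fin (order G) ⊎ Fin (order H) → Set
  JAdj (inj₁ a) (inj₁ b) = Adj G a b
  JAdj (inj₂ a) (inj₂ b) = Adj H a b
  JAdj (inj₁ _) (inj₂ _) = ⊤
  JAdj (inj₂ _) (inj₁ _) = ⊤

  JAdj-sym : ∀ x y → JAdj x y → JAdj y x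
  JAdj-sym (inj₁ a) (inj₁ b) p = Graph.sym G p
  JAdj-sym (inj₂ a) (inj₂ b) p = Graph.sym H p
  JAdj-sym (inj₁ _) (inj₂ _) _ = _
  JAdj-sym (inj₂ _) (inj₁ _) _ = _

  JAdj-irrefl : ∀ x → ¬ JAdj x x
  JAdj-irrefl (inj₁ a) = irrefl G
  JAdj-irrefl (inj₂ a) = irrefl H

_∨ᴳ_ : Graph → Graph → Graph
G ∨ᴳ H = record
  { order  = order G + order H
  ; Adj    = λ u v → JAdj G H (splitAt (order G) u) (splitAt (order G) v)
  ; sym    = λ {u} {v} → JAdj-sym G H (splitAt (order G) u) (splitAt (order G) v)
  ; irrefl = λ {u} → JAdj-irrefl G H (splitAt (order G) u)
  }

K1[_],_ : ℕ → ℕ → Graph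
K1[ n ], m = O m ∨ᴳ K n

-- Walks staying inside a vertex subset S (paths in the induced subgraph G[S]).
data Reach (G : Graph) (S : Subset (order G)) : Fin (order G) → Fin (order G) → Set where
  here : ∀ {u} → Reach G S u u
  step : ∀ {u w v} → Adj G u w → w ∈ S → Reach G S w v → Reach G S u v

InducedConnected : (G : Graph) → Subset (order G) → Set
InducedConnected G S = Nonempty S × (∀ u v → u ∈ S → v ∈ S → Reach G S u v)

sumOver : ∀ {k} → (Fin k → ℕ) → Subset k → ℕ
sumOver f []       = 0
sumOver f (b ∷ S)  = (if b then f Fin.zero else 0) + sumOver (λ i → f (Fin.suc i)) S

total : (G : Graph) → (Fin (order G) → ℕ) → ℕ
total G f = sumOver f ⊤ˢ

IsIC : (G : Graph) → (Fin (order G) → ℕ) → Set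
IsIC G f = (∀ v → 1 ≤ f v)
         × (∀ k → 1 ≤ k → k ≤ total G f →
              Σ (Subset (order G)) λ S → InducedConnected G S × sumOver f S ≡ k)

-- "M(G) ≥ N": some IC-coloring f of G has f(G) ≥ N
-- (M(G) is the maximum of f(G) over IC-colorings).
ICIndex≥ : Graph → ℕ → Set
ICIndex≥ G N = Σ (Fin (order G) → ℕ) λ f → IsIC G f × N ≤ total G f

-- Give the first vertex of O_m weight 1 and the clique vertices weights 2, 4, …, 2ⁿ, so that
-- sub-multisets of these n + 1 weights realise every value below 2ⁿ⁺¹; give the other m − 1
-- independent vertices weights B, 2B, …, 2ᵐ⁻²B, where B = 2ⁿ⁺¹ − 2 is the weight of the clique.
-- Every k ≥ 2 up to the total is then 2 + r + cB with r < B and c < 2ᵐ⁻¹, and 2 + r ≥ 2 forces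
-- a clique vertex into the chosen set; a clique vertex is adjacent to all others, so the set
-- induces a connected subgraph. The total weight is 2ᵐ(2ⁿ − 1) + 1.
module Submission where

open import Defs hiding (sym)
open import Data.Nat using (ℕ; zero; suc; _+_; _*_; _∸_; _^_; _≤_; _<_; z≤n; s≤s; _/_; _%_)
open import Data.Nat.Properties
  using (+-assoc; *-zeroʳ; *-distribˡ-+; *-suc; *-comm; *-assoc; *-mono-≤; *-cancelˡ-<
        ; ≤-trans; ≤-reflexive; ≤-pred; m≤n+m; m^n>0; ^-distribˡ-+-*; m+n∸m≡n; +-comm)
open import Data.Nat.DivMod using (m≡m%n+[m/n]*n; m%n<n; m<n*o⇒m/o<n)
open import Data.Fin using (Fin; splitAt; toℕ; _↑ˡ_; _↑ʳ_)
import Data.Fin as F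
open import Data.Fin.Properties using (splitAt-↑ˡ; splitAt-↑ʳ; splitAt⁻¹-↑ʳ)
open import Data.Fin.Subset using (Subset; _∈_; Nonempty; ⁅_⁆) renaming (⊤ to ⊤ˢ; ⊥ to ⊥ˢ)
open import Data.Fin.Subset.Properties using (x∈⁅x⁆; x∈⁅y⁆⇒x≡y)
open import Data.Vec using ([]; _∷_; _++_; here; there)
open import Data.Vec.Properties using (lookup-++ʳ; []=⇒lookup; lookup⇒[]=)
open import Data.Bool using (Bool; true; false; if_then_else_)
open import Data.Sum using (inj₁; inj₂; [_,_]′)
open import Data.Unit using (tt)
open import Data.Product using (Σ; _×_; _,_; ∃₂)
open import Relation.Nullary using (¬_; yes; no)
open import Relation.Binary.PropositionalEquality
  using (_≡_; refl; sym; trans; cong; cong₂; subst; module ≡-Reasoning)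

sumOver-cong : ∀ {k} {f g : Fin k → ℕ} → (∀ i → f i ≡ g i) → ∀ S → sumOver f S ≡ sumOver g S
sumOver-cong f≗g []          = refl
sumOver-cong f≗g (true ∷ S)  = cong₂ _+_ (f≗g F.zero) (sumOver-cong (λ i → f≗g (F.suc i)) S)
sumOver-cong f≗g (false ∷ S) = sumOver-cong (λ i → f≗g (F.suc i)) S

sumOver-*ˡ : ∀ {k} c (f : Fin k → ℕ) S → sumOver (λ i → c * f i) S ≡ c * sumOver f S
sumOver-*ˡ c f []          = sym (*-zeroʳ c)
sumOver-*ˡ c f (true ∷ S)  =
  trans (cong (c * f F.zero +_) (sumOver-*ˡ c _ S)) (sym (*-distribˡ-+ c _ _))
sumOver-*ˡ c f (false ∷ S) = sumOver-*ˡ c _ S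

sumOver-⊥ : ∀ {k} (f : Fin k → ℕ) → sumOver f ⊥ˢ ≡ 0
sumOver-⊥ {zero}  f = refl
sumOver-⊥ {suc k} f = sumOver-⊥ {k} _

sumOver-++ : ∀ {m n} (f : Fin (m + n) → ℕ) (xs : Subset m) (ys : Subset n) →
  sumOver f (xs ++ ys) ≡ sumOver (λ i → f (i ↑ˡ n)) xs + sumOver (λ j → f (m ↑ʳ j)) ys
sumOver-++ f []           ys = refl
sumOver-++ f (true ∷ xs)  ys =
  trans (cong (f F.zero +_) (sumOver-++ _ xs ys)) (sym (+-assoc (f F.zero) _ _))
sumOver-++ f (false ∷ xs) ys = sumOver-++ _ xs ys

sumOver-join : ∀ {m n} (g : Fin m → ℕ) (h : Fin n → ℕ) (xs : Subset m) (ys : Subset n) →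
  sumOver (λ i → [ g , h ]′ (splitAt m i)) (xs ++ ys) ≡ sumOver g xs + sumOver h ys
sumOver-join {m} {n} g h xs ys = trans (sumOver-++ _ xs ys)
  (cong₂ _+_ (sumOver-cong (λ i → cong [ g , h ]′ (splitAt-↑ˡ m i n)) xs)
             (sumOver-cong (λ j → cong [ g , h ]′ (splitAt-↑ʳ m n j)) ys))

sumOver-nonempty : ∀ {k} (f : Fin k → ℕ) S → 1 ≤ sumOver f S → Nonempty S
sumOver-nonempty f []          ()
sumOver-nonempty f (true ∷ S)  _ = F.zero , here
sumOver-nonempty f (false ∷ S) p with sumOver-nonempty _ S p
... | j , j∈S = F.suc j , there j∈S

⊤-++ : ∀ m n → ⊤ˢ {m + n} ≡ ⊤ˢ {m} ++ ⊤ˢ {n}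
⊤-++ zero    n = refl
⊤-++ (suc m) n = cong (true ∷_) (⊤-++ m n)

∈-++⁺ʳ : ∀ {m n} (xs : Subset m) {ys : Subset n} {j} → j ∈ ys → m ↑ʳ j ∈ xs ++ ys
∈-++⁺ʳ {m} xs {ys} {j} j∈ys =
  lookup⇒[]= (m ↑ʳ j) (xs ++ ys) (trans (lookup-++ʳ xs ys j) ([]=⇒lookup j∈ys))

pow2 : ∀ {p} → Fin p → ℕ
pow2 j = 2 ^ toℕ j

bit : Bool → ℕ
bit b = if b then 1 else 0

parity : ∀ t → ∃₂ λ e q → t ≡ bit e + 2 * q
parity zero = false , 0 , refl
parity (suc t) with parity t
... | false , q , t≡ = true , q , cong suc t≡
... | true  , q , t≡ = false , suc q , trans (cong suc t≡) (sym (*-suc 2 q))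

binaryExpansion : ∀ p t → t < 2 ^ p → Σ (Subset p) λ xs → sumOver pow2 xs ≡ t
binaryExpansion zero    zero    _ = [] , refl
binaryExpansion zero    (suc t) (s≤s ())
binaryExpansion (suc p) t t<2^1+p with parity t
... | e , q , t≡ with binaryExpansion p q q<2^p
  where
    q<2^p : q < 2 ^ p
    q<2^p = *-cancelˡ-< 2 q (2 ^ p)
      (≤-trans (s≤s (m≤n+m (2 * q) (bit e))) (subst (_< 2 ^ suc p) t≡ t<2^1+p))
... | xs , xs≡q =
  e ∷ xs , trans (cong (bit e +_) (trans (sumOver-*ˡ 2 pow2 xs) (cong (2 *_) xs≡q))) (sym t≡)

ones : ℕ → ℕ
ones p = sumOver (pow2 {p}) ⊤ˢ

suc-ones : ∀ p → suc (ones p) ≡ 2 ^ p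
suc-ones zero    = refl
suc-ones (suc p) = begin
  suc (suc (sumOver (λ j → 2 * pow2 j) (⊤ˢ {p})))
    ≡⟨ cong (λ x → suc (suc x)) (sumOver-*ˡ 2 pow2 (⊤ˢ {p})) ⟩
  suc (suc (2 * ones p)) ≡⟨ sym (*-suc 2 (ones p)) ⟩
  2 * suc (ones p)       ≡⟨ cong (2 *_) (suc-ones p) ⟩
  2 * 2 ^ p              ∎
  where open ≡-Reasoning

Universal : (G : Graph) → Fin (order G) → Set
Universal G w = ∀ u → ¬ u ≡ w → Adj G u w

universal⇒connected : ∀ {G S w} → Universal G w → w ∈ S → InducedConnected G S
universal⇒connected {G} {S} {w} univ w∈S = (w , w∈S) , reach
  where
    fromW : ∀ v → v ∈ S → Reach G S w v
    fromW v v∈S with v F.≟ w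
    ... | yes refl = here
    ... | no  v≢w  = step (Graph.sym G (univ v v≢w)) v∈S here

    reach : ∀ u v → u ∈ S → v ∈ S → Reach G S u v
    reach u v _ v∈S with u F.≟ w
    ... | yes refl = fromW v v∈S
    ... | no  u≢w  = step (univ u u≢w) w∈S (fromW v v∈S)

⁅⁆-connected : ∀ {G} (v : Fin (order G)) → InducedConnected G ⁅ v ⁆
⁅⁆-connected {G} v = (v , x∈⁅x⁆ v) , reach
  where
    reach : ∀ a b → a ∈ ⁅ v ⁆ → b ∈ ⁅ v ⁆ → Reach G ⁅ v ⁆ a b
    reach a b a∈ b∈ with x∈⁅y⁆⇒x≡y v a∈ | x∈⁅y⁆⇒x≡y v b∈
    ... | refl | refl = here

K-universal : ∀ n (j : Fin n) → Universal (K n) j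
K-universal n j u u≢j = u≢j

∨ᴳ-universalʳ : ∀ G H {j} → Universal H j → Universal (G ∨ᴳ H) (order G ↑ʳ j)
∨ᴳ-universalʳ G H {j} univ u u≢w rewrite splitAt-↑ʳ (order G) (order H) j =
  adjacent (splitAt (order G) u) (λ u≡ → u≢w (sym (splitAt⁻¹-↑ʳ u≡)))
  where
    adjacent : ∀ x → ¬ x ≡ inj₂ j → JAdj G H x (inj₂ j)
    adjacent (inj₁ a) _   = tt
    adjacent (inj₂ a) a≢j = univ a (λ a≡j → a≢j (cong inj₂ a≡j))

module Coloring (m′ n′ : ℕ) where
  m n : ℕ
  m = suc m′
  n = suc n′

  G : Graph
  G = K1[ n ], m

  cliqueWeight : Fin n → ℕ
  cliqueWeight j = pow2 (F.suc j)

  B : ℕ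
  B = sumOver cliqueWeight ⊤ˢ

  independentWeight : Fin m → ℕ
  independentWeight F.zero    = 1
  independentWeight (F.suc j) = B * pow2 j

  coloring : Fin (m + n) → ℕ
  coloring i = [ independentWeight , cliqueWeight ]′ (splitAt m i)

  -- The independent vertex 0 together with the clique carries the weights 2⁰, …, 2ⁿ.
  coloring-++ : ∀ e xs ys →
    sumOver coloring ((e ∷ xs) ++ ys) ≡ sumOver pow2 (e ∷ ys) + B * sumOver pow2 xs
  coloring-++ e xs ys = begin
    sumOver coloring ((e ∷ xs) ++ ys)
      ≡⟨ sumOver-join independentWeight cliqueWeight (e ∷ xs) ys ⟩
    (bit e + sumOver (λ i → B * pow2 i) xs) + sumOver cliqueWeight ys
      ≡⟨ cong (λ x → (bit e + x) + sumOver cliqueWeight ys) (sumOver-*ˡ B pow2 xs) ⟩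
    (bit e + B * sumOver pow2 xs) + sumOver cliqueWeight ys
      ≡⟨ +-assoc (bit e) _ _ ⟩
    bit e + (B * sumOver pow2 xs + sumOver cliqueWeight ys)
      ≡⟨ cong (bit e +_) (+-comm _ (sumOver cliqueWeight ys)) ⟩
    bit e + (sumOver cliqueWeight ys + B * sumOver pow2 xs)
      ≡⟨ sym (+-assoc (bit e) _ _) ⟩
    sumOver pow2 (e ∷ ys) + B * sumOver pow2 xs ∎
    where open ≡-Reasoning

  B≡2*ones : B ≡ 2 * ones n
  B≡2*ones = sumOver-*ˡ 2 pow2 (⊤ˢ {n})

  total-coloring : total G coloring ≡ suc (2 ^ m′ * B)
  total-coloring = begin
    sumOver coloring (⊤ˢ {m + n})        ≡⟨ cong (sumOver coloring) (⊤-++ m n) ⟩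
    sumOver coloring (⊤ˢ {m} ++ ⊤ˢ)      ≡⟨ coloring-++ true (⊤ˢ {m′}) (⊤ˢ {n}) ⟩
    suc B + B * ones m′                  ≡⟨ cong suc (sym (*-suc B (ones m′))) ⟩
    suc (B * suc (ones m′))              ≡⟨ cong (λ x → suc (B * x)) (suc-ones m′) ⟩
    suc (B * 2 ^ m′)                     ≡⟨ cong suc (*-comm B (2 ^ m′)) ⟩
    suc (2 ^ m′ * B)                     ∎
    where open ≡-Reasoning

  coloring-positive : ∀ v → 1 ≤ coloring v
  coloring-positive v with splitAt m {n} v
  ... | inj₁ F.zero    = s≤s z≤n
  ... | inj₁ (F.suc j) = *-mono-≤ {1} {B} (s≤s z≤n) (m^n>0 2 (toℕ j))
  ... | inj₂ j         = m^n>0 2 (suc (toℕ j))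

  clique-meets⇒connected : ∀ (xs : Subset m) ys → Nonempty ys → InducedConnected G (xs ++ ys)
  clique-meets⇒connected xs ys (j , j∈ys) =
    universal⇒connected (∨ᴳ-universalʳ (O m) (K n) (K-universal n j)) (∈-++⁺ʳ xs j∈ys)

  bit+x≡2+r⇒1≤x : ∀ e x r → bit e + x ≡ 2 + r → 1 ≤ x
  bit+x≡2+r⇒1≤x false x r refl = s≤s z≤n
  bit+x≡2+r⇒1≤x true  x r refl = s≤s z≤n

  realise-≥2 : ∀ K → K < 2 ^ m′ * B →
    Σ (Subset (m + n)) λ S → InducedConnected G S × sumOver coloring S ≡ 2 + K
  realise-≥2 K K<2^m′*B with binaryExpansion m′ (K / B) (m<n*o⇒m/o<n K<2^m′*B)
                          | binaryExpansion (suc n) (2 + K % B) 2+K%B<2^1+n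
    where
      2+K%B<2^1+n : 2 + K % B < 2 ^ suc n
      2+K%B<2^1+n = subst (2 + K % B <_) (suc-ones (suc n)) (s≤s (s≤s (m%n<n K B)))
  ... | xs , xs≡K/B | e ∷ ys , e∷ys≡2+K%B =
    (e ∷ xs) ++ ys
    , clique-meets⇒connected (e ∷ xs) ys
        (sumOver-nonempty cliqueWeight ys (bit+x≡2+r⇒1≤x e _ (K % B) e∷ys≡2+K%B))
    , (begin
        sumOver coloring ((e ∷ xs) ++ ys)      ≡⟨ coloring-++ e xs ys ⟩
        sumOver pow2 (e ∷ ys) + B * sumOver pow2 xs
                                               ≡⟨ cong₂ (λ a b → a + B * b) e∷ys≡2+K%B xs≡K/B ⟩
        2 + K % B + B * (K / B)                ≡⟨ cong (λ x → 2 + K % B + x) (*-comm B (K / B)) ⟩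
        2 + (K % B + K / B * B)                ≡⟨ cong (2 +_) (sym (m≡m%n+[m/n]*n K B)) ⟩
        2 + K                                  ∎)
    where open ≡-Reasoning

  realise : ∀ k → 1 ≤ k → k ≤ total G coloring →
    Σ (Subset (m + n)) λ S → InducedConnected G S × sumOver coloring S ≡ k
  realise (suc zero)    _ _ = ⁅ F.zero ⁆ , ⁅⁆-connected F.zero , cong suc (sumOver-⊥ {m′ + n} _)
  realise (suc (suc K)) _ k≤total =
    realise-≥2 K (≤-pred (subst (2 + K ≤_) total-coloring k≤total))

  coloring-IC : IsIC G coloring
  coloring-IC = coloring-positive , realise

  2^[m+n]∸2^m+1≡total : 2 ^ (m + n) ∸ 2 ^ m + 1 ≡ total G coloring
  2^[m+n]∸2^m+1≡total = begin
    2 ^ (m + n) ∸ 2 ^ m + 1          ≡⟨ cong (λ x → x ∸ 2 ^ m + 1) (^-distribˡ-+-* 2 m n) ⟩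
    2 ^ m * 2 ^ n ∸ 2 ^ m + 1        ≡⟨ cong (λ x → 2 ^ m * x ∸ 2 ^ m + 1) (sym (suc-ones n)) ⟩
    2 ^ m * suc (ones n) ∸ 2 ^ m + 1 ≡⟨ cong (λ x → x ∸ 2 ^ m + 1) (*-suc (2 ^ m) (ones n)) ⟩
    2 ^ m + 2 ^ m * ones n ∸ 2 ^ m + 1
                                     ≡⟨ cong (_+ 1) (m+n∸m≡n (2 ^ m) _) ⟩
    2 * 2 ^ m′ * ones n + 1          ≡⟨ +-comm _ 1 ⟩
    suc (2 * 2 ^ m′ * ones n)        ≡⟨ cong (λ x → suc (x * ones n)) (*-comm 2 (2 ^ m′)) ⟩
    suc (2 ^ m′ * 2 * ones n)        ≡⟨ cong suc (*-assoc (2 ^ m′) 2 (ones n)) ⟩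
    suc (2 ^ m′ * (2 * ones n))      ≡⟨ cong (λ x → suc (2 ^ m′ * x)) (sym B≡2*ones) ⟩
    suc (2 ^ m′ * B)                 ≡⟨ sym total-coloring ⟩
    total G coloring                 ∎
    where open ≡-Reasoning

corollary3p2 : ∀ (m n : ℕ) → 1 ≤ m → 1 ≤ n →
    ICIndex≥ (K1[ n ], m) (2 ^ (m + n) ∸ 2 ^ m + 1)
corollary3p2 (suc m′) (suc n′) _ _ =
  coloring , coloring-IC , ≤-reflexive 2^[m+n]∸2^m+1≡total
  where open Coloring m′ n′
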